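{- Let $k$ be a positive integer. If there exist an even integer $u\ge2$ and an integer $t\ge2$ such that $L_{u+t+2}(k)=0\,1\,0^t\,1^u$ and $U_{2u-1}(k)=1^u\,0^{u-1}$, then $f(k)<k$.
   Context: $s_2(n)$ is the binary sum of digits of $n\ge0$, $t_n=s_2(n)\bmod 2$, and $f(k)=\min\{n\ge0: t_{kn}=1\}$ for $k\ge1$. If $k=\sum_{i=0}^{\ell-1}\varepsilon_i 2^i$ with $\varepsilon_i\in\{0,1\}$, $\varepsilon_{\ell-1}=1$, then $\ell=\ell(k)$ is the binary length; for $1\le j\le \ell(k)$, $L_j(k)=\varepsilon_{j-1}\cdots\varepsilon_0$ is the word of the $j$ least significant binary digits and $U_j(k)=\varepsilon_{\ell-1}\cdots\varepsilon_{\ell-j}$ is the word of the $j$ most significant binary digits (use of $L_j(k)$ or $U_j(k)$ presupposes $\ell(k)\ge j$). For $a\in\{0,1\}$, $a^n$ denotes the word consisting of $n$ copies of $a$ ($a^0$ is empty); juxtaposition denotes concatenation. -}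

module Defs where

open import Data.Nat using (ℕ; zero; suc; _+_; _*_; _<_; _≤_)
open import Data.Nat.DivMod using (_/_; _%_)
open import Data.List using (List; []; _∷_; length; reverse; take)
open import Data.Nat.ListAction using (sum)
open import Data.Product using (_×_)
open import Relation.Binary.PropositionalEquality using (_≡_)

-- binary digits, least significant first, with no leading zeros
-- (the first argument is fuel; n steps always suffice for n)
bitsAux : ℕ → ℕ → List ℕ
bitsAux zero    _       = []
bitsAux (suc f) zero    = []
bitsAux (suc f) (suc n) = (suc n % 2) ∷ bitsAux f (suc n / 2)

bits : ℕ → List ℕ
bits n = bitsAux n n

len : ℕ → ℕ
len k = length (bits k)

s₂ : ℕ → ℕ
s₂ n = sum (bits n)

tm : ℕ → ℕ
tm n = s₂ n % 2

-- L_j(k) = ε_{j-1} ⋯ ε_0 (written most significant first)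
L : ℕ → ℕ → List ℕ
L j k = reverse (take j (bits k))

-- U_j(k) = ε_{ℓ-1} ⋯ ε_{ℓ-j}
U : ℕ → ℕ → List ℕ
U j k = take j (reverse (bits k))

-- "f(k) = m": m is the least n ≥ 0 with t_{kn} = 1
IsF : ℕ → ℕ → Set
IsF k m = (tm (k * m) ≡ 1) × (∀ n → n < m → tm (k * n) ≡ 0)

{-# OPTIONS --safe #-}
-- Take n = 2^m − 1, with m chosen so that H = ⌊k / 2^m⌋, read most significant digit first,
-- is 1^u (H = 2^u − 1) or 1^u 0 (H = 2^(u+1) − 2), both prefixes of U(k); then n < k. For odd k,
--   k (2^m − 1) = (k − H − 1) 2^m + (2^m − k mod 2^m),
-- and the last term is the m-digit complement of (k mod 2^m) − 1, whence
--   s₂(k n) + s₂(k) = s₂(k − H − 1) + s₂(H) + m + 1.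
-- Since the low digits of k are 1^u 0^t 1 0 (least significant first), k − H − 1 is k with
-- these digits replaced by 1^(u+t) 0 0, resp. 0^u 1^t 0 0, so s₂(k n) = u + t + m, resp. t + m.
-- The two choices of m differ by one and u is even, so one of them makes s₂(k n) odd.
module Submission where

open import Defs
open import Data.Nat using (ℕ; zero; suc; _+_; _*_; _∸_; _^_; _<_; _≤_; z≤n; s≤s; z<s)
open import Data.Nat.Properties
open import Data.Nat.DivMod
open import Data.Nat.Divisibility using (_∣_; divides; m∣m*n)
open import Data.Nat.ListAction using (sum)
open import Data.Nat.ListAction.Properties using (sum-++)
open import Data.Nat.Tactic.RingSolver using (solve-∀)
open import Data.List using (List; []; _∷_; _∷ʳ_; _++_; replicate; take; drop; reverse; length)
open import Data.List.Properties using (++-assoc; length-++; reverse-++; reverse-involutive; unfold-reverse; take++drop≡id; ∷-injectiveˡ)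
open import Data.List.Relation.Unary.All using (All; []; _∷_)
open import Data.List.Relation.Unary.All.Properties using (++⁺; ++⁻ʳ; replicate⁺)
open import Data.Product using (Σ; _×_; _,_; proj₁; proj₂; map₂)
open import Data.Sum using (_⊎_; inj₁; inj₂; [_,_]′)
open import Data.Empty using (⊥-elim)
open import Function using (_∘_)
open import Algebra.Properties.CommutativeSemigroup +-commutativeSemigroup using (xy∙z≈xz∙y)
open import Relation.Binary.PropositionalEquality

infixl 7 _/2^_
_/2^_ : ℕ → ℕ → ℕ
n /2^ m = _/_ n (2 ^ m) {{m^n≢0 2 m}}

data Parity : ℕ → Set where
  even : ∀ a → Parity (a * 2)
  odd  : ∀ a → Parity (suc (a * 2))

parity : ∀ n → Parity n
parity zero = even 0
parity (suc n) with parity n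
... | even a = odd a
... | odd a  = even (suc a)

even%2 : ∀ a → a * 2 % 2 ≡ 0
even%2 a = m*n%n≡0 a 2

odd%2 : ∀ a → suc (a * 2) % 2 ≡ 1
odd%2 a = [m+kn]%n≡m%n 1 a 2

odd/2 : ∀ a → suc (a * 2) / 2 ≡ a
odd/2 a = trans (+-distrib-/ 1 (a * 2) (subst (λ r → 1 + r < 2) (sym (even%2 a)) ≤-refl))
                (m*n/n≡m a 2)

*2≢1+*2 : ∀ a b → a * 2 ≢ suc (b * 2)
*2≢1+*2 a b e = 0≢1+n (trans (sym (even%2 a)) (trans (cong (_% 2) e) (odd%2 b)))

%2-0⊎1 : ∀ n → n % 2 ≡ 0 ⊎ n % 2 ≡ 1
%2-0⊎1 n with n % 2 | m%n<n n 2
... | 0           | _             = inj₁ refl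
... | 1           | _             = inj₂ refl
... | suc (suc _) | s≤s (s≤s ())

[1+n+h*2]%2≡1 : ∀ n h → n % 2 ≡ 0 → (suc n + h * 2) % 2 ≡ 1
[1+n+h*2]%2≡1 n h n-even = begin
  (suc n + h * 2) % 2        ≡⟨ [m+kn]%n≡m%n (suc n) h 2 ⟩
  (1 + n) % 2                ≡⟨ %-distribˡ-+ 1 n 2 ⟩
  (1 + n % 2) % 2            ≡⟨ cong (λ r → (1 + r) % 2) n-even ⟩
  1                          ∎
  where open ≡-Reasoning

-- Binary digits

suc-half≤ : ∀ n → suc n / 2 ≤ n
suc-half≤ n = <⇒≤pred (m/n<m (suc n) 2 ≤-refl)

bitsAux-fuel : ∀ {f g} n → n ≤ f → n ≤ g → bitsAux f n ≡ bitsAux g n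
bitsAux-fuel {zero}  {zero}  zero _ _ = refl
bitsAux-fuel {zero}  {suc g} zero _ _ = refl
bitsAux-fuel {suc f} {zero}  zero _ _ = refl
bitsAux-fuel {suc f} {suc g} zero _ _ = refl
bitsAux-fuel {suc f} {suc g} (suc n) (s≤s n≤f) (s≤s n≤g) =
  cong (suc n % 2 ∷_) (bitsAux-fuel (suc n / 2) (≤-trans (suc-half≤ n) n≤f) (≤-trans (suc-half≤ n) n≤g))

bits-suc : ∀ n → bits (suc n) ≡ suc n % 2 ∷ bits (suc n / 2)
bits-suc n = cong (suc n % 2 ∷_) (bitsAux-fuel (suc n / 2) (suc-half≤ n) ≤-refl)

val : List ℕ → ℕ
val []       = 0
val (d ∷ ds) = d + val ds * 2

val-bitsAux : ∀ f n → n ≤ f → val (bitsAux f n) ≡ n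
val-bitsAux zero    zero    _         = refl
val-bitsAux (suc f) zero    _         = refl
val-bitsAux (suc f) (suc n) (s≤s n≤f) =
  trans (cong (λ v → suc n % 2 + v * 2) (val-bitsAux f (suc n / 2) (≤-trans (suc-half≤ n) n≤f)))
        (sym (m≡m%n+[m/n]*n (suc n) 2))

val-bits : ∀ n → val (bits n) ≡ n
val-bits n = val-bitsAux n n ≤-refl

Binary : List ℕ → Set
Binary = All (_< 2)

1<2 : 1 < 2
1<2 = s≤s z<s

binary-bitsAux : ∀ f n → Binary (bitsAux f n)
binary-bitsAux zero    _       = []
binary-bitsAux (suc f) zero    = []
binary-bitsAux (suc f) (suc n) = m%n<n (suc n) 2 ∷ binary-bitsAux f (suc n / 2)

binary-bits : ∀ n → Binary (bits n)
binary-bits n = binary-bitsAux n n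

bits-head : ∀ {n d ds} → bits n ≡ d ∷ ds → n % 2 ≡ d
bits-head {suc n} e = ∷-injectiveˡ (trans (sym (bits-suc n)) e)

bits-positive : ∀ {n d ds} → bits n ≡ d ∷ ds → 1 ≤ n
bits-positive {suc n} _ = s≤s z≤n

drop-bits : ∀ m n → drop m (bits n) ≡ bits (n /2^ m)
drop-bits zero    n       = cong bits (sym (n/1≡n n))
drop-bits (suc m) zero    = cong bits (sym (0/n≡0 (2 ^ suc m) {{m^n≢0 2 (suc m)}}))
drop-bits (suc m) (suc n) = begin
  drop (suc m) (bits (suc n))   ≡⟨ cong (drop (suc m)) (bits-suc n) ⟩
  drop m (bits (suc n / 2))     ≡⟨ drop-bits m (suc n / 2) ⟩
  bits (suc n / 2 /2^ m)        ≡⟨ cong bits (m/n/o≡m/[n*o] (suc n) 2 (2 ^ m) {{_}} {{m^n≢0 2 m}} {{m^n≢0 2 (suc m)}}) ⟩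
  bits (suc n /2^ suc m)        ∎
  where open ≡-Reasoning

drop-length-++ : ∀ (xs : List ℕ) {ys} → drop (length xs) (xs ++ ys) ≡ ys
drop-length-++ []       = refl
drop-length-++ (_ ∷ xs) = drop-length-++ xs

bits-/2^-suffix : ∀ {k} ys {top} → bits k ≡ ys ++ top → bits (k /2^ length ys) ≡ top
bits-/2^-suffix {k} ys eq = trans (sym (drop-bits (length ys) k)) (trans (cong (drop (length ys)) eq) (drop-length-++ ys))

-- Binary digit sums

s₂-step : ∀ n → s₂ n ≡ n % 2 + s₂ (n / 2)
s₂-step zero    = refl
s₂-step (suc n) = cong sum (bits-suc n)

s₂-even : ∀ a → s₂ (a * 2) ≡ s₂ a
s₂-even a = trans (s₂-step (a * 2)) (cong₂ (λ r q → r + s₂ q) (even%2 a) (m*n/n≡m a 2))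

s₂-odd : ∀ a → s₂ (suc (a * 2)) ≡ suc (s₂ a)
s₂-odd a = trans (s₂-step (suc (a * 2))) (cong₂ (λ r q → r + s₂ q) (odd%2 a) (odd/2 a))

s₂-val : ∀ {ds} → Binary ds → s₂ (val ds) ≡ sum ds
s₂-val []                          = refl
s₂-val {0 ∷ ds} (_ ∷ b)            = trans (s₂-even (val ds)) (s₂-val b)
s₂-val {1 ∷ ds} (_ ∷ b)            = trans (s₂-odd (val ds)) (cong suc (s₂-val b))
s₂-val {suc (suc _) ∷ _} (s≤s (s≤s ()) ∷ _)

half-< : ∀ {q} m → q * 2 < 2 ^ suc m → q < 2 ^ m
half-< {q} m h = *-cancelʳ-< 2 q (2 ^ m) (subst (q * 2 <_) (*-comm 2 (2 ^ m)) h)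

half-≡ : ∀ {q} m → q * 2 ≡ 2 ^ suc m → q ≡ 2 ^ m
half-≡ {q} m h = *-cancelʳ-≡ q (2 ^ m) 2 (trans h (*-comm 2 (2 ^ m)))

s₂-+-*2^ : ∀ m a b → b < 2 ^ m → s₂ (b + a * 2 ^ m) ≡ s₂ b + s₂ a
s₂-+-*2^ zero a zero _ = cong s₂ (*-identityʳ a)
s₂-+-*2^ zero a (suc b) (s≤s ())
s₂-+-*2^ (suc m) a b b< with parity b
... | even q = begin
  s₂ (q * 2 + a * 2 ^ suc m)   ≡⟨ cong s₂ (shift q a (2 ^ m)) ⟩
  s₂ ((q + a * 2 ^ m) * 2)     ≡⟨ s₂-even (q + a * 2 ^ m) ⟩
  s₂ (q + a * 2 ^ m)           ≡⟨ s₂-+-*2^ m a q (half-< m b<) ⟩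
  s₂ q + s₂ a                  ≡⟨ cong (_+ s₂ a) (sym (s₂-even q)) ⟩
  s₂ (q * 2) + s₂ a            ∎
  where
  open ≡-Reasoning
  shift : ∀ q a M → q * 2 + a * (2 * M) ≡ (q + a * M) * 2
  shift = solve-∀
... | odd q = begin
  s₂ (suc (q * 2) + a * 2 ^ suc m)   ≡⟨ cong (s₂ ∘ suc) (shift q a (2 ^ m)) ⟩
  s₂ (suc ((q + a * 2 ^ m) * 2))     ≡⟨ s₂-odd (q + a * 2 ^ m) ⟩
  suc (s₂ (q + a * 2 ^ m))           ≡⟨ cong suc (s₂-+-*2^ m a q (half-< m (<-trans (n<1+n _) b<))) ⟩
  suc (s₂ q + s₂ a)                  ≡⟨ cong (_+ s₂ a) (sym (s₂-odd q)) ⟩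
  s₂ (suc (q * 2)) + s₂ a            ∎
  where
  open ≡-Reasoning
  shift : ∀ q a M → q * 2 + a * (2 * M) ≡ (q + a * M) * 2
  shift = solve-∀

s₂-complement : ∀ m x y → suc (x + y) ≡ 2 ^ m → s₂ x + s₂ y ≡ m
s₂-complement zero    zero    zero    refl = refl
s₂-complement zero    zero    (suc y) ()
s₂-complement zero    (suc x) y       ()
s₂-complement (suc m) x       y       e with parity x | parity y
... | even a | even b = ⊥-elim (*2≢1+*2 (2 ^ m) (a + b)
      (trans (*-comm (2 ^ m) 2) (trans (sym e) (cong suc (sym (*-distribʳ-+ 2 a b))))))
... | odd a  | odd b  = ⊥-elim (*2≢1+*2 (2 ^ m) (suc (a + b))
      (trans (*-comm (2 ^ m) 2) (trans (sym e) (cong suc (carry a b)))))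
  where
  carry : ∀ a b → suc (a * 2) + suc (b * 2) ≡ suc (a + b) * 2
  carry = solve-∀
... | even a | odd b  = begin
  s₂ (a * 2) + s₂ (suc (b * 2))  ≡⟨ cong₂ _+_ (s₂-even a) (s₂-odd b) ⟩
  s₂ a + suc (s₂ b)              ≡⟨ +-suc (s₂ a) (s₂ b) ⟩
  suc (s₂ a + s₂ b)              ≡⟨ cong suc (s₂-complement m a b (half-≡ m (trans (no-carry a b) e))) ⟩
  suc m                          ∎
  where
  open ≡-Reasoning
  no-carry : ∀ a b → suc (a + b) * 2 ≡ suc (a * 2 + suc (b * 2))
  no-carry = solve-∀
... | odd a  | even b = begin
  s₂ (suc (a * 2)) + s₂ (b * 2)  ≡⟨ cong₂ _+_ (s₂-odd a) (s₂-even b) ⟩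
  suc (s₂ a + s₂ b)              ≡⟨ cong suc (s₂-complement m a b (half-≡ m (trans (no-carry a b) e))) ⟩
  suc m                          ∎
  where
  open ≡-Reasoning
  no-carry : ∀ a b → suc (a + b) * 2 ≡ suc (suc (a * 2) + b * 2)
  no-carry = solve-∀

-- Multiplying by 2^m − 1

odd-half : ∀ n → n % 2 ≡ 1 → Σ ℕ λ q → n ≡ suc (q * 2)
odd-half n n-odd with parity n
... | even a = ⊥-elim (0≢1+n (trans (sym (even%2 a)) n-odd))
... | odd a  = a , refl

*[M∸1] : ∀ {k M R H D} → 0 < M → R ≤ M → k ≡ R + H * M → D + H + 1 ≡ k →
         k * (M ∸ 1) ≡ (M ∸ R) + D * M
*[M∸1] {k} {M} {R} {H} {D} 0<M R≤M k≡ D+H+1≡k = +-cancelʳ-≡ k _ _ (begin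
  k * (M ∸ 1) + k                   ≡⟨ *-+1 k (M ∸ 1) ⟩
  k * (M ∸ 1 + 1)                   ≡⟨ cong (k *_) (m∸n+n≡m 0<M) ⟩
  k * M                             ≡⟨ cong (_* M) (sym D+H+1≡k) ⟩
  (D + H + 1) * M                   ≡⟨ subst (λ X → (D + H + 1) * X ≡ (M ∸ R) + D * X + (R + H * X))
                                            (m∸n+n≡m R≤M) (expand (M ∸ R) R D H) ⟩
  (M ∸ R) + D * M + (R + H * M)     ≡⟨ cong ((M ∸ R) + D * M +_) (sym k≡) ⟩
  (M ∸ R) + D * M + k               ∎)
  where
  open ≡-Reasoning
  *-+1 : ∀ k x → k * x + k ≡ k * (x + 1)
  *-+1 = solve-∀
  expand : ∀ W R D H → (D + H + 1) * (W + R) ≡ W + D * (W + R) + (R + H * (W + R))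
  expand = solve-∀

s₂-*-mersenne : ∀ {k} m D → k % 2 ≡ 1 → 1 ≤ m → D + k /2^ m + 1 ≡ k →
                s₂ (k * (2 ^ m ∸ 1)) + s₂ k ≡ s₂ D + s₂ (k /2^ m) + m + 1
s₂-*-mersenne {k} m@(suc m′) D k-odd _ D+H+1≡k = begin
  s₂ (k * (M ∸ 1)) + s₂ k                     ≡⟨ cong₂ (λ x y → s₂ x + s₂ y) product split ⟩
  s₂ (W + D * M) + s₂ (suc (q * 2) + H * M)   ≡⟨ cong₂ _+_ (s₂-+-*2^ m D W W<M) (s₂-+-*2^ m H (suc (q * 2)) R<M) ⟩
  (s₂ W + s₂ D) + (s₂ (suc (q * 2)) + s₂ H)   ≡⟨ cong (λ x → (s₂ W + s₂ D) + (x + s₂ H)) (s₂-odd q) ⟩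
  (s₂ W + s₂ D) + (suc (s₂ q) + s₂ H)         ≡⟨ regroup (s₂ W) (s₂ D) (s₂ q) (s₂ H) ⟩
  s₂ D + s₂ H + (s₂ W + s₂ q) + 1             ≡⟨ cong (λ x → s₂ D + s₂ H + x + 1) complement ⟩
  s₂ D + s₂ H + m + 1                         ∎
  where
  open ≡-Reasoning
  instance _ = m^n≢0 2 m
  M = 2 ^ m
  H = k /2^ m
  odd-rem = odd-half (k % M) (trans (m∣n⇒o%n%m≡o%m 2 M k (m∣m*n (2 ^ m′))) k-odd)
  q = proj₁ odd-rem
  split : k ≡ suc (q * 2) + H * M
  split = trans (m≡m%n+[m/n]*n k M) (cong (_+ H * M) (proj₂ odd-rem))
  R<M : suc (q * 2) < M
  R<M = subst (_< M) (proj₂ odd-rem) (m%n<n k M)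
  W = M ∸ suc (q * 2)
  W+R≡M : W + suc (q * 2) ≡ M
  W+R≡M = m∸n+n≡m (<⇒≤ R<M)
  W<M : W < M
  W<M = subst (W <_) W+R≡M (m<m+n W z<s)
  product : k * (M ∸ 1) ≡ W + D * M
  product = *[M∸1] {H = H} {D = D} (m^n>0 2 m) (<⇒≤ R<M) split D+H+1≡k
  complement : s₂ W + s₂ q ≡ m
  complement = trans (cong (s₂ W +_) (sym (s₂-even q)))
                     (s₂-complement m W (q * 2) (trans (sym (+-suc W (q * 2))) W+R≡M))
  regroup : ∀ w d q h → (w + d) + (suc q + h) ≡ d + h + (w + q) + 1
  regroup = solve-∀

all-zero-or-IsF : ∀ k N → (∀ n → n < N → tm (k * n) ≡ 0) ⊎ Σ ℕ (λ m → IsF k m × m < N)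
all-zero-or-IsF k zero = inj₁ (λ _ ())
all-zero-or-IsF k (suc N) with all-zero-or-IsF k N | %2-0⊎1 (s₂ (k * N))
... | inj₂ (m , isF , m<N) | _          = inj₂ (m , isF , m<n⇒m<1+n m<N)
... | inj₁ below           | inj₂ one   = inj₂ (N , (one , below) , ≤-refl)
... | inj₁ below           | inj₁ zero′ = inj₁ λ n n<1+N →
  [ below n , (λ { refl → zero′ }) ]′ (m<1+n⇒m<n∨m≡n n<1+N)

f<k-of-witness : ∀ {k n} → tm (k * n) ≡ 1 → n < k → Σ ℕ (λ m → IsF k m × m < k)
f<k-of-witness {k} {n} one n<k with all-zero-or-IsF k k
... | inj₂ found = found
... | inj₁ below = ⊥-elim (0≢1+n (trans (sym (below n n<k)) one))

f<k-of-mersenne : ∀ {k} m → 1 ≤ k /2^ m → tm (k * (2 ^ m ∸ 1)) ≡ 1 → Σ ℕ (λ f → IsF k f × f < k)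
f<k-of-mersenne {k} m 1≤H one = f<k-of-witness one (begin-strict
  2 ^ m ∸ 1   <⟨ ∸-monoʳ-< z<s (m^n>0 2 m) ⟩
  2 ^ m ∸ 0   ≤⟨ m/n≢0⇒n≤m {{m^n≢0 2 m}} (n>0⇒n≢0 1≤H) ⟩
  k           ∎)
  where open ≤-Reasoning

-- Digit patterns

val-++ : ∀ xs ys → val (xs ++ ys) ≡ val xs + val ys * 2 ^ length xs
val-++ []       ys = sym (*-identityʳ (val ys))
val-++ (d ∷ xs) ys = trans (cong (λ v → d + v * 2) (val-++ xs ys)) (shift d (val xs) (val ys) (2 ^ length xs))
  where
  shift : ∀ d x y M → d + (x + y * M) * 2 ≡ d + x * 2 + y * (2 * M)
  shift = solve-∀

sum-replicate : ∀ n x → sum (replicate n x) ≡ n * x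
sum-replicate zero    x = refl
sum-replicate (suc n) x = cong (x +_) (sum-replicate n x)

length-replicate-++ : ∀ n {x y} {ys zs : List ℕ} → length ys ≡ length zs →
                      length (replicate n x ++ ys) ≡ length (replicate n y ++ zs)
length-replicate-++ zero    eq = eq
length-replicate-++ (suc n) eq = cong suc (length-replicate-++ n eq)

replace-low-digits : ∀ {k low rest} low′ c → bits k ≡ low ++ rest → Binary low′ →
                     length low′ ≡ length low → val low′ + c ≡ val low →
                     Σ ℕ λ D → (D + c ≡ k) × (s₂ D + sum low ≡ sum low′ + s₂ k)
replace-low-digits {k} {low} {rest} low′ c k≡ binary-low′ |low′|≡|low| value =
  val (low′ ++ rest) , D+c≡k , s₂-D
  where
  open ≡-Reasoning
  D+c≡k : val (low′ ++ rest) + c ≡ k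
  D+c≡k = begin
    val (low′ ++ rest) + c                          ≡⟨ cong (_+ c) (val-++ low′ rest) ⟩
    val low′ + val rest * 2 ^ length low′ + c        ≡⟨ xy∙z≈xz∙y (val low′) _ c ⟩
    val low′ + c + val rest * 2 ^ length low′        ≡⟨ cong₂ (λ v l → v + val rest * 2 ^ l) value |low′|≡|low| ⟩
    val low + val rest * 2 ^ length low              ≡⟨ sym (val-++ low rest) ⟩
    val (low ++ rest)                                ≡⟨ cong val (sym k≡) ⟩
    val (bits k)                                     ≡⟨ val-bits k ⟩
    k                                                ∎
  s₂-D : s₂ (val (low′ ++ rest)) + sum low ≡ sum low′ + s₂ k
  s₂-D = begin
    s₂ (val (low′ ++ rest)) + sum low    ≡⟨ cong (_+ sum low) (s₂-val (++⁺ binary-low′ (++⁻ʳ low (subst Binary k≡ (binary-bits k))))) ⟩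
    sum (low′ ++ rest) + sum low         ≡⟨ cong (_+ sum low) (sum-++ low′ rest) ⟩
    sum low′ + sum rest + sum low        ≡⟨ swap (sum low′) (sum rest) (sum low) ⟩
    sum low′ + (sum low + sum rest)      ≡⟨ cong (sum low′ +_) (sym (trans (cong sum k≡) (sum-++ low rest))) ⟩
    sum low′ + s₂ k                      ∎
    where
    swap : ∀ a b c → a + b + c ≡ a + (c + b)
    swap = solve-∀

s₂-*-mersenne-by-digits : ∀ {k} m {low rest top} low′ → 1 ≤ m → k % 2 ≡ 1 →
  bits k ≡ low ++ rest → bits (k /2^ m) ≡ top →
  Binary low′ → length low′ ≡ length low → val low′ + (val top + 1) ≡ val low →
  s₂ (k * (2 ^ m ∸ 1)) + sum low ≡ sum low′ + sum top + m + 1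
s₂-*-mersenne-by-digits {k} m {low} {rest} {top} low′ 1≤m k-odd k≡ H≡ binary-low′ |low′|≡|low| value
  with replace-low-digits {low = low} {rest} low′ (val top + 1) k≡ binary-low′ |low′|≡|low| value
... | D , D+c≡k , s₂-D = +-cancelʳ-≡ (s₂ k) _ _ (begin
  s₂ (k * (2 ^ m ∸ 1)) + sum low + s₂ k      ≡⟨ xy∙z≈xz∙y (s₂ (k * (2 ^ m ∸ 1))) (sum low) (s₂ k) ⟩
  s₂ (k * (2 ^ m ∸ 1)) + s₂ k + sum low      ≡⟨ cong (_+ sum low) (s₂-*-mersenne m D k-odd 1≤m D+H+1≡k) ⟩
  s₂ D + s₂ H + m + 1 + sum low              ≡⟨ cong (λ h → s₂ D + h + m + 1 + sum low) s₂-H ⟩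
  s₂ D + sum top + m + 1 + sum low           ≡⟨ regroup (s₂ D) (sum top) m (sum low) ⟩
  s₂ D + sum low + (sum top + m + 1)         ≡⟨ cong (_+ (sum top + m + 1)) s₂-D ⟩
  sum low′ + s₂ k + (sum top + m + 1)        ≡⟨ regroup′ (sum low′) (s₂ k) (sum top) m ⟩
  sum low′ + sum top + m + 1 + s₂ k          ∎)
  where
  open ≡-Reasoning
  H = k /2^ m
  H≡val-top : H ≡ val top
  H≡val-top = trans (sym (val-bits H)) (cong val H≡)
  s₂-H : s₂ H ≡ sum top
  s₂-H = cong sum H≡
  D+H+1≡k : D + H + 1 ≡ k
  D+H+1≡k = trans (+-assoc D H 1) (trans (cong (λ h → D + (h + 1)) H≡val-top) D+c≡k)
  regroup : ∀ d t m l → d + t + m + 1 + l ≡ d + l + (t + m + 1)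
  regroup = solve-∀
  regroup′ : ∀ d s t m → d + s + (t + m + 1) ≡ d + t + m + 1 + s
  regroup′ = solve-∀

block : ℕ → ℕ → ℕ → ℕ → ℕ → List ℕ
block u a t b c = replicate u a ++ replicate t b ++ c ∷ 0 ∷ []

length-block : ∀ u t {a b c a′ b′ c′} → length (block u a t b c) ≡ length (block u a′ t b′ c′)
length-block u t = length-replicate-++ u (length-replicate-++ t refl)

binary-block : ∀ u t {a b c} → a < 2 → b < 2 → c < 2 → Binary (block u a t b c)
binary-block u t a<2 b<2 c<2 = ++⁺ (replicate⁺ u a<2) (++⁺ (replicate⁺ t b<2) (c<2 ∷ z<s ∷ []))

sum-block : ∀ u a t b c → sum (block u a t b c) ≡ u * a + (t * b + (c + 0))
sum-block u a t b c = trans (sum-++ (replicate u a) _) (cong₂ _+_ (sum-replicate u a)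
                        (trans (sum-++ (replicate t b) _) (cong (_+ (c + 0)) (sum-replicate t b))))

val-ones : ∀ n → val (replicate n 1) + 1 ≡ 2 ^ n
val-ones zero    = refl
val-ones (suc n) = trans (double (val (replicate n 1))) (cong (2 *_) (val-ones n))
  where
  double : ∀ v → 1 + v * 2 + 1 ≡ 2 * (v + 1)
  double = solve-∀

val-carry : ∀ t xs → val (replicate t 1 ++ 0 ∷ xs) + 1 ≡ val (replicate t 0 ++ 1 ∷ xs)
val-carry zero    xs = +-comm (val xs * 2) 1
val-carry (suc t) xs = trans (double (val (replicate t 1 ++ 0 ∷ xs))) (cong (_* 2) (val-carry t xs))
  where
  double : ∀ v → 1 + v * 2 + 1 ≡ (v + 1) * 2
  double = solve-∀

val-replicate-++-+2^ : ∀ n x {as bs} → val as + 1 ≡ val bs →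
                       val (replicate n x ++ as) + 2 ^ n ≡ val (replicate n x ++ bs)
val-replicate-++-+2^ zero    x eq = eq
val-replicate-++-+2^ (suc n) x {as} eq =
  trans (double x (val (replicate n x ++ as)) (2 ^ n)) (cong (λ v → x + v * 2) (val-replicate-++-+2^ n x eq))
  where
  double : ∀ x v M → x + v * 2 + 2 * M ≡ x + (v + M) * 2
  double = solve-∀

val-fill-ones : ∀ n xs → val (replicate n 0 ++ xs) + val (replicate n 1) ≡ val (replicate n 1 ++ xs)
val-fill-ones zero    xs = +-identityʳ (val xs)
val-fill-ones (suc n) xs =
  trans (double (val (replicate n 0 ++ xs)) (val (replicate n 1))) (cong (λ v → 1 + v * 2) (val-fill-ones n xs))
  where
  double : ∀ v w → v * 2 + (1 + w * 2) ≡ 1 + (v + w) * 2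
  double = solve-∀

val-block-low : ∀ u t → val (block u 1 t 1 0) + 2 ^ u ≡ val (block u 1 t 0 1)
val-block-low u t = val-replicate-++-+2^ u 1 (val-carry t (0 ∷ []))

val-block-high : ∀ u t → val (block u 0 t 1 0) + val (replicate u 1) + 2 ^ u ≡ val (block u 1 t 0 1)
val-block-high u t = trans (cong (_+ 2 ^ u) (val-fill-ones u _)) (val-block-low u t)

f<k-if-top-ones : ∀ {k rest} u t m → 1 ≤ u → 1 ≤ m → bits k ≡ block u 1 t 0 1 ++ rest →
                  bits (k /2^ m) ≡ replicate u 1 → (u + t + m) % 2 ≡ 1 → Σ ℕ (λ f → IsF k f × f < k)
f<k-if-top-ones {k} {rest} u@(suc _) t m _ 1≤m k≡ H≡ c-odd =
  f<k-of-mersenne m (bits-positive H≡) (trans (cong (_% 2) s₂-product) c-odd)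
  where
  open ≡-Reasoning
  value : val (block u 1 t 1 0) + (val (replicate u 1) + 1) ≡ val (block u 1 t 0 1)
  value = trans (cong (val (block u 1 t 1 0) +_) (val-ones u)) (val-block-low u t)
  s₂-product : s₂ (k * (2 ^ m ∸ 1)) ≡ u + t + m
  s₂-product = +-cancelʳ-≡ (sum (block u 1 t 0 1)) _ _ (begin
    s₂ (k * (2 ^ m ∸ 1)) + sum (block u 1 t 0 1)
      ≡⟨ s₂-*-mersenne-by-digits m {rest = rest} (block u 1 t 1 0) 1≤m (bits-head k≡) k≡ H≡
           (binary-block u t 1<2 1<2 z<s) (length-block u t) value ⟩
    sum (block u 1 t 1 0) + sum (replicate u 1) + m + 1
      ≡⟨ cong₂ (λ d o → d + o + m + 1) (sum-block u 1 t 1 0) (sum-replicate u 1) ⟩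
    u * 1 + (t * 1 + 0) + u * 1 + m + 1
      ≡⟨ regroup u t m ⟩
    u + t + m + (u * 1 + (t * 0 + 1))
      ≡⟨ cong (u + t + m +_) (sym (sum-block u 1 t 0 1)) ⟩
    u + t + m + sum (block u 1 t 0 1)     ∎)
    where
    regroup : ∀ u t m → u * 1 + (t * 1 + 0) + u * 1 + m + 1 ≡ u + t + m + (u * 1 + (t * 0 + 1))
    regroup = solve-∀

f<k-if-top-zero-ones : ∀ {k rest} u t m → 1 ≤ u → 1 ≤ m → bits k ≡ block u 1 t 0 1 ++ rest →
                       bits (k /2^ m) ≡ 0 ∷ replicate u 1 → (t + m) % 2 ≡ 1 → Σ ℕ (λ f → IsF k f × f < k)
f<k-if-top-zero-ones {k} {rest} u@(suc _) t m _ 1≤m k≡ H≡ c-odd =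
  f<k-of-mersenne m (bits-positive H≡) (trans (cong (_% 2) s₂-product) c-odd)
  where
  open ≡-Reasoning
  V = val (replicate u 1)
  value : val (block u 0 t 1 0) + (V * 2 + 1) ≡ val (block u 1 t 0 1)
  value = begin
    val (block u 0 t 1 0) + (V * 2 + 1)    ≡⟨ split (val (block u 0 t 1 0)) V ⟩
    val (block u 0 t 1 0) + V + (V + 1)    ≡⟨ cong (val (block u 0 t 1 0) + V +_) (val-ones u) ⟩
    val (block u 0 t 1 0) + V + 2 ^ u      ≡⟨ val-block-high u t ⟩
    val (block u 1 t 0 1)                  ∎
    where
    split : ∀ d v → d + (v * 2 + 1) ≡ d + v + (v + 1)
    split = solve-∀
  s₂-product : s₂ (k * (2 ^ m ∸ 1)) ≡ t + m
  s₂-product = +-cancelʳ-≡ (sum (block u 1 t 0 1)) _ _ (begin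
    s₂ (k * (2 ^ m ∸ 1)) + sum (block u 1 t 0 1)
      ≡⟨ s₂-*-mersenne-by-digits m {rest = rest} (block u 0 t 1 0) 1≤m (bits-head k≡) k≡ H≡
           (binary-block u t z<s 1<2 z<s) (length-block u t) value ⟩
    sum (block u 0 t 1 0) + sum (replicate u 1) + m + 1
      ≡⟨ cong₂ (λ d o → d + o + m + 1) (sum-block u 0 t 1 0) (sum-replicate u 1) ⟩
    u * 0 + (t * 1 + 0) + u * 1 + m + 1
      ≡⟨ regroup u t m ⟩
    t + m + (u * 1 + (t * 0 + 1))
      ≡⟨ cong (t + m +_) (sym (sum-block u 1 t 0 1)) ⟩
    t + m + sum (block u 1 t 0 1)         ∎)
    where
    regroup : ∀ u t m → u * 0 + (t * 1 + 0) + u * 1 + m + 1 ≡ t + m + (u * 1 + (t * 0 + 1))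
    regroup = solve-∀

nonempty-prefix : ∀ {l xs ys zs : List ℕ} → l ≡ 1 ∷ xs → l ≡ ys ++ 0 ∷ zs → 1 ≤ length ys
nonempty-prefix {ys = []}    p q = ⊥-elim (1+n≢0 (∷-injectiveˡ (trans (sym p) q)))
nonempty-prefix {ys = _ ∷ _} _ _ = s≤s z≤n

f<k-of-digit-patterns : ∀ {k rest ys} u t → 1 ≤ u → 2 ∣ u →
  bits k ≡ block u 1 t 0 1 ++ rest → bits k ≡ ys ++ 0 ∷ replicate u 1 → Σ ℕ (λ f → IsF k f × f < k)
f<k-of-digit-patterns {ys = ys} u@(suc _) t 1≤u (divides h u≡h*2) low≡ high≡ with %2-0⊎1 (t + length ys)
... | inj₂ odd-sum  = f<k-if-top-zero-ones u t (length ys) 1≤u (nonempty-prefix low≡ high≡) low≡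
                        (bits-/2^-suffix ys high≡) odd-sum
... | inj₁ even-sum = f<k-if-top-ones u t (length (ys ++ 0 ∷ [])) 1≤u 1≤m low≡
                        (bits-/2^-suffix (ys ++ 0 ∷ []) (trans high≡ (sym (++-assoc ys (0 ∷ []) _)))) odd-sum
  where
  m≡ : length (ys ++ 0 ∷ []) ≡ length ys + 1
  m≡ = length-++ ys
  1≤m : 1 ≤ length (ys ++ 0 ∷ [])
  1≤m = subst (1 ≤_) (sym m≡) (m≤n+m 1 (length ys))
  odd-sum : (u + t + length (ys ++ 0 ∷ [])) % 2 ≡ 1
  odd-sum = trans (cong (_% 2) (trans (cong₂ (λ v m → v + t + m) u≡h*2 m≡) (regroup h t (length ys))))
                  ([1+n+h*2]%2≡1 (t + length ys) h even-sum)
    where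
    regroup : ∀ h t l → h * 2 + t + (l + 1) ≡ suc (t + l) + h * 2
    regroup = solve-∀

reverse-replicate : ∀ n (x : ℕ) → reverse (replicate n x) ≡ replicate n x
reverse-replicate zero    x = refl
reverse-replicate (suc n) x = begin
  reverse (x ∷ replicate n x)   ≡⟨ unfold-reverse x (replicate n x) ⟩
  reverse (replicate n x) ∷ʳ x  ≡⟨ cong (_∷ʳ x) (reverse-replicate n x) ⟩
  replicate n x ∷ʳ x            ≡⟨ replicate-∷ʳ n ⟩
  x ∷ replicate n x             ∎
  where
  open ≡-Reasoning
  replicate-∷ʳ : ∀ n → replicate n x ∷ʳ x ≡ x ∷ replicate n x
  replicate-∷ʳ zero    = refl
  replicate-∷ʳ (suc n) = cong (x ∷_) (replicate-∷ʳ n)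

bits-low-digits : ∀ {j k w} → L j k ≡ w → bits k ≡ reverse w ++ drop j (bits k)
bits-low-digits {j} {k} L≡w = begin
  bits k                               ≡⟨ sym (take++drop≡id j (bits k)) ⟩
  take j (bits k) ++ drop j (bits k)   ≡⟨ cong (_++ drop j (bits k)) (sym (reverse-involutive _)) ⟩
  reverse (L j k) ++ drop j (bits k)   ≡⟨ cong (λ w → reverse w ++ drop j (bits k)) L≡w ⟩
  _                                    ∎
  where open ≡-Reasoning

bits-high-digits : ∀ {j k} w w′ → U j k ≡ w ++ w′ → Σ (List ℕ) λ ys → bits k ≡ ys ++ reverse w
bits-high-digits {j} {k} w w′ U≡ = reverse (w′ ++ drop j rb) , (begin
  bits k                              ≡⟨ sym (reverse-involutive (bits k)) ⟩
  reverse rb                          ≡⟨ cong reverse (sym (take++drop≡id j rb)) ⟩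
  reverse (U j k ++ drop j rb)        ≡⟨ cong (λ l → reverse (l ++ drop j rb)) U≡ ⟩
  reverse ((w ++ w′) ++ drop j rb)    ≡⟨ cong reverse (++-assoc w w′ (drop j rb)) ⟩
  reverse (w ++ (w′ ++ drop j rb))    ≡⟨ reverse-++ w (w′ ++ drop j rb) ⟩
  reverse (w′ ++ drop j rb) ++ reverse w ∎)
  where
  open ≡-Reasoning
  rb = reverse (bits k)

reverse-low-pattern : ∀ u t → reverse (0 ∷ 1 ∷ (replicate t 0 ++ replicate u 1)) ≡ block u 1 t 0 1
reverse-low-pattern u t = begin
  reverse ((0 ∷ 1 ∷ []) ++ (replicate t 0 ++ replicate u 1))   ≡⟨ reverse-++ (0 ∷ 1 ∷ []) (replicate t 0 ++ replicate u 1) ⟩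
  reverse (replicate t 0 ++ replicate u 1) ++ 1 ∷ 0 ∷ []        ≡⟨ cong (_++ 1 ∷ 0 ∷ []) (reverse-++ (replicate t 0) _) ⟩
  (reverse (replicate u 1) ++ reverse (replicate t 0)) ++ 1 ∷ 0 ∷ []
    ≡⟨ cong₂ (λ a b → (a ++ b) ++ 1 ∷ 0 ∷ []) (reverse-replicate u 1) (reverse-replicate t 0) ⟩
  (replicate u 1 ++ replicate t 0) ++ 1 ∷ 0 ∷ []               ≡⟨ ++-assoc (replicate u 1) _ _ ⟩
  block u 1 t 0 1                                             ∎
  where open ≡-Reasoning

reverse-high-pattern : ∀ u → reverse (replicate u 1 ++ 0 ∷ []) ≡ 0 ∷ replicate u 1
reverse-high-pattern u = trans (reverse-++ (replicate u 1) (0 ∷ [])) (cong (0 ∷_) (reverse-replicate u 1))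

-- 1 ≤ k and the length hypotheses are implied by the shapes of L and U.
lemma5 : (k : ℕ) → 1 ≤ k → (u t : ℕ) → 2 ∣ u → 2 ≤ u → 2 ≤ t →
    u + t + 2 ≤ len k →
    L (u + t + 2) k ≡ 0 ∷ 1 ∷ (replicate t 0 ++ replicate u 1) →
    2 * u ∸ 1 ≤ len k →
    U (2 * u ∸ 1) k ≡ replicate u 1 ++ replicate (u ∸ 1) 0 →
    Σ ℕ (λ m → IsF k m × m < k)
lemma5 k _ u@(suc (suc v)) t 2∣u (s≤s (s≤s _)) _ _ L≡ _ U≡ =
  f<k-of-digit-patterns u t (s≤s z≤n) 2∣u low-digits (proj₂ high-digits)
  where
  low-digits : bits k ≡ block u 1 t 0 1 ++ drop (u + t + 2) (bits k)
  low-digits = trans (bits-low-digits {u + t + 2} L≡) (cong (_++ drop (u + t + 2) (bits k)) (reverse-low-pattern u t))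
  high-digits : Σ (List ℕ) λ ys → bits k ≡ ys ++ 0 ∷ replicate u 1
  high-digits = map₂ (λ {ys} eq → trans eq (cong (ys ++_) (reverse-high-pattern u)))
    (bits-high-digits (replicate u 1 ++ 0 ∷ []) (replicate v 0)
      (trans U≡ (sym (++-assoc (replicate u 1) (0 ∷ []) (replicate v 0)))))
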